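{- Let $G$ be a finite graph, let $\pi$ be a lion strategy on $G$, and let $\pi'$ be obtained from $\pi$ by adding any set of remote contamination operations. If $\pi'$ clears $G$, then $\pi$ also clears $G$.
   Context: Lions and contamination game on a finite graph $G=(V,E)$, $N(v)$ the neighbours of $v$. A lion strategy with $k\ge1$ lions: initial positions $p_i(0)$, and $p_i(t)\in\{p_i(t-1)\}\cup N(p_i(t-1))$ for $t\ge1$; $L_t=\{p_i(t)\}_i$, $\pi_t=\{(p_i(t-1),p_i(t))\}_i$. Contaminated sets: $W_0=V\setminus L_0$; $W_t=(W_{t-1}\setminus L_t)\cup\{v\in V\setminus L_t:\exists w\in W_{t-1}\cap N(v),\ (v,w)\notin\pi_t,(w,v)\notin\pi_t\}$; $C_t=V\setminus W_t$. The strategy clears $G$ if $W_T=\emptyset$ for some $T$. Remote operations (analytical tool): a strategy may be augmented by a set of pairs $(v,t)$ designated remote clears and a set designated remote contaminations; in the augmented run, after computing $W_t$ by the rule above (from the augmented $W_{t-1}$), each vertex $v$ with a remote clear at time $t$ is removed from $W_t$ and each vertex with a remote contamination at time $t$ is added to $W_t$, regardless of lions or neighbours. An augmented strategy clears $G$ if its contaminated set is empty at some time. -}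

module Defs where

open import Data.Nat using (ℕ; zero; suc; _≤_)
open import Data.Fin using (Fin; _≟_)
open import Data.Bool using (Bool; true; false; not; _∧_; _∨_)
open import Data.List using (List)
open import Data.Bool.ListAction using (any)
open import Data.List using () renaming (allFin to allFinL)
open import Data.Product using (∃; _×_)
open import Data.Sum using (_⊎_)
open import Relation.Nullary.Decidable using (⌊_⌋)
open import Relation.Binary.PropositionalEquality using (_≡_)

record Graph (n : ℕ) : Set where
  field
    adj   : Fin n → Fin n → Bool
    sym   : ∀ v w → adj v w ≡ adj w v
    irrefl : ∀ v → adj v v ≡ false
open Graph public

-- Positions of k lions over time: p t i = p_i(t).
Positions : ℕ → ℕ → Set
Positions n k = ℕ → Fin k → Fin n

IsStrategy : ∀ {n k} → Graph n → Positions n k → Set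
IsStrategy G p = ∀ t i → (p (suc t) i ≡ p t i) ⊎ (adj G (p t i) (p (suc t) i) ≡ true)

inL : ∀ {n k} → Positions n k → ℕ → Fin n → Bool
inL {k = k} p t v = any (λ i → ⌊ p t i ≟ v ⌋) (allFinL k)

-- (v , w) ∈ π_{t+1} = {(p_i(t), p_i(t+1))}
inπ : ∀ {n k} → Positions n k → ℕ → Fin n → Fin n → Bool
inπ {k = k} p t v w = any (λ i → ⌊ p t i ≟ v ⌋ ∧ ⌊ p (suc t) i ≟ w ⌋) (allFinL k)

Remote : ℕ → Set
Remote n = ℕ → Fin n → Bool

noRemote : ∀ {n} → Remote n
noRemote _ _ = false

W : ∀ {n k} → Graph n → Positions n k → Remote n → ℕ → Fin n → Bool
W G p rc zero v = not (inL p zero v) ∨ rc zero v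
W {n} G p rc (suc t) v =
  (not (inL p (suc t) v) ∧
     (W G p rc t v ∨
      any (λ w → adj G v w ∧ W G p rc t w ∧ not (inπ p t v w) ∧ not (inπ p t w v))
          (allFinL n)))
  ∨ rc (suc t) v

Clears : ∀ {n k} → Graph n → Positions n k → Remote n → Set
Clears G p rc = ∃ λ T → ∀ v → W G p rc T v ≡ false

module Submission where

open import Defs
open import Data.Nat using (zero; suc; _≤_)
open import Data.Fin using (Fin)
open import Data.Bool using (Bool; true; false; not; _∧_; _∨_; f≤t; b≤b)
  renaming (_≤_ to _≤ᵇ_)
open import Data.Bool.Properties using (≤-minimum; ≤-maximum)
open import Data.List using ([]; _∷_) renaming (allFin to allFinL)
open import Data.Bool.ListAction using (any)
open import Data.Product using (_,_)
open import Relation.Binary.PropositionalEquality using (_≡_; refl; subst)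

-- A remote contamination only adds vertices to W_t, and the update rule is
-- monotone in W_{t-1}; so at every time the contaminated set of π is
-- contained in that of π′, and empties whenever the latter does.

∨-mono-≤ : ∀ {a b c d} → a ≤ᵇ b → c ≤ᵇ d → (a ∨ c) ≤ᵇ (b ∨ d)
∨-mono-≤ f≤t _ = ≤-maximum _
∨-mono-≤ {true}  b≤b _ = b≤b
∨-mono-≤ {false} b≤b q = q

∧-mono-≤ : ∀ {a b c d} → a ≤ᵇ b → c ≤ᵇ d → (a ∧ c) ≤ᵇ (b ∧ d)
∧-mono-≤ f≤t _ = ≤-minimum _
∧-mono-≤ {true}  b≤b q = q
∧-mono-≤ {false} b≤b _ = b≤b

any-mono-≤ : ∀ {A : Set} {f g : A → Bool} → (∀ x → f x ≤ᵇ g x) →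
             ∀ xs → any f xs ≤ᵇ any g xs
any-mono-≤ f≤g []       = b≤b
any-mono-≤ f≤g (x ∷ xs) = ∨-mono-≤ (f≤g x) (any-mono-≤ f≤g xs)

W-noRemote-≤ : ∀ {n k} (G : Graph n) (p : Positions n k) (rc : Remote n) t v →
               W G p noRemote t v ≤ᵇ W G p rc t v
W-noRemote-≤ G p rc zero v = ∨-mono-≤ b≤b (≤-minimum (rc zero v))
W-noRemote-≤ {n} G p rc (suc t) v =
  ∨-mono-≤ (∧-mono-≤ b≤b (∨-mono-≤ (W-noRemote-≤ G p rc t v)
                                    (any-mono-≤ spread-≤ (allFinL n))))
           (≤-minimum (rc (suc t) v))
  where
  spreads : Remote n → Fin n → Bool
  spreads rc′ w = adj G v w ∧ W G p rc′ t w ∧ not (inπ p t v w) ∧ not (inπ p t w v)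

  spread-≤ : ∀ w → spreads noRemote w ≤ᵇ spreads rc w
  spread-≤ w = ∧-mono-≤ {adj G v w} b≤b (∧-mono-≤ (W-noRemote-≤ G p rc t w) b≤b)

≤false⇒≡false : ∀ {a} → a ≤ᵇ false → a ≡ false
≤false⇒≡false b≤b = refl

lemma6 : ∀ {n k} (G : Graph n) → 1 ≤ k → (p : Positions n k) → IsStrategy G p →
           (rc : Remote n) → Clears G p rc → Clears G p noRemote
lemma6 G _ p _ rc (T , W-empty) =
  T , λ v → ≤false⇒≡false (subst (_ ≤ᵇ_) (W-empty v) (W-noRemote-≤ G p rc T v))
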